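{- Let $(T,C,H,B)$ be an observation table arising in a run of the algorithm LearnCMTA at a moment when it is closed and consistent, and let $\mathcal{A}$ be the CMTA produced from it by ExtractCMTA. Then for every $t\in T$ and every $c\in C$, $\mathcal{A}(c[t])=H[t][c]$.
   Context: Ranked alphabet $\Sigma=(\Sigma_0,\ldots,\Sigma_p)$; $\mathrm{Trees}(\Sigma)$ are ordered trees with nodes labelled $\sigma\in\Sigma_k$ having $k$ children. A context is a tree with an extra rank-0 symbol $\diamond$ occurring once; $c[t]$ replaces $\diamond$ by $t$. The unknown target is a tree series $\mathcal{T}:\mathrm{Trees}(\Sigma)\to\mathbb{R}$; $H[t][c]=\mathcal{T}(c[t])$ (Hankel matrix entries, obtained by membership queries). Rows $H[t_1]$, $H[t_2]$ (restricted to the current columns) are co-linear with scalar $\alpha\neq0$, written $t_1\equiv^\alpha_H t_2$, if $H[t_1]=\alpha H[t_2]$; zero rows are co-linear with each other. A multiplicity tree automaton $(\Sigma,\mathbb{R},d,\mu,\lambda)$ has $\lambda\in\mathbb{R}^d$ and $k$-linear maps $\mu_\sigma$ with coefficients $\mu_\sigma{}^{i}_{j_1\ldots j_k}$ for $\sigma\in\Sigma_k$; $\mu(\sigma(t_1,\ldots,t_k))=\mu_\sigma(\mu(t_1),\ldots,\mu(t_k))$, $\mathcal{A}(t)=\lambda\cdot\mu(t)$. Observation table $(T,C,H,B)$: $T$ a set of trees, $C$ a set of contexts containing $\diamond$, $H$ the entries for rows $T\cup\Sigma(T)$ and columns $C$, $B=\{b_1,\ldots,b_d\}\subseteq T$ with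 nonzero, pairwise non-co-linear rows. $\Sigma(T)=\{\sigma(t_1,\ldots,t_k):\sigma\in\Sigma_k,t_i\in T\}$; $\Sigma(T,t)$: trees of $\Sigma(T)$ with $t$ as a child; $\Sigma(T,\diamond)$: contexts $\sigma(t_1,\ldots,\diamond,\ldots,t_k)$ with $t_i\in T$. Closed: every row of $\Sigma(T)$ is zero or co-linear to the row of some $b\in B$. Zero-consistent: for all $t\in T$ with $H[t]=\bar0$, all $t'\in\Sigma(T,t)$, $c\in C$, $H[c[t']]=0$. Co-linear consistent: for all $t_1,t_2\in T$ with $t_1\equiv^\alpha_H t_2$ and every $c\in\Sigma(T,\diamond)$, $c[t_1]\equiv^\alpha_H c[t_2]$. Consistent = both. In LearnCMTA, $T$ is closed under taking subtrees, elements of $B$ are added only from $\Sigma(T)$ when their row is not co-linear to existing representatives (so children of elements of $B$ lie in $B$), contexts are added to $C$ only as compositions $c'[c]$ with $c'\in C$ witnessing a consistency violation, and the table is completed until it is closed and consistent. ExtractCMTA: $\lambda[j]=H[b_j][\diamond]$; for $\sigma\in\Sigma_k$ and $(i_1,\ldots,i_k)\in\{1..d\}^k$ with $t=\sigma(b_{i_1},\ldots,b_{i_k})$: if $H[t]$ is zero then $\mu_\sigma{}^{j}_{i_1\ldots i_k}=0$ for all $j$; otherwise, for the unique $i$ and $\alpha$ with $t\equiv^\alpha_H b_i$, set $\mu_\sigma{}^{i}_{i_1\ldots i_k}=\alpha$ and $\mu_\sigma{}^{j}_{i_1\ldots i_k}=0$ for $j\neq i$. -}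

module Defs where

open import Level using (Level; _⊔_) renaming (suc to lsuc; zero to lzero)
open import Data.Nat using (ℕ; zero; suc)
open import Data.Fin using (Fin; zero; suc)
open import Data.Vec using (Vec; []; _∷_; lookup)
import Data.Vec as Vec
open import Data.Vec.Relation.Unary.All using (All)
open import Data.Vec.Relation.Unary.Any using (Any)
open import Data.List using (List)
open import Data.List.Membership.Propositional using (_∈_)
open import Data.Empty using (⊥)
open import Data.Unit using (⊤; tt)
open import Data.Product using (Σ; ∃; ∃-syntax; _×_; _,_)
open import Data.Sum using (_⊎_)
open import Relation.Nullary using (¬_)
open import Relation.Binary.PropositionalEquality using (_≡_; _≢_)
open import Algebra.Apartness.Bundles using (HeytingField)

record RankedAlphabet : Set₁ where
  field
    Sym   : Set
    arity : Sym → ℕ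

-- Trees over a ranked alphabet, with variables in A.
-- Trees(Σ) = Tr ⊥ ; contexts are Tr ⊤ in which the hole ◇ = var tt
-- occurs exactly once.

module Trees (Σ' : RankedAlphabet) where
  open RankedAlphabet Σ'

  data Tr (A : Set) : Set where
    var  : A → Tr A
    node : (σ : Sym) → Vec (Tr A) (arity σ) → Tr A

  Tree : Set
  Tree = Tr ⊥

  Ctx : Set
  Ctx = Tr ⊤

  ◇ : Ctx
  ◇ = var tt

  mutual
    bind : {A B : Set} → (A → Tr B) → Tr A → Tr B
    bind f (var a)     = f a
    bind f (node σ ts) = node σ (bindV f ts)

    bindV : {A B : Set} {n : ℕ} → (A → Tr B) → Vec (Tr A) n → Vec (Tr B) n
    bindV f []       = []
    bindV f (t ∷ ts) = bind f t ∷ bindV f ts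

  mutual
    holes : Ctx → ℕ
    holes (var _)     = 1
    holes (node σ ts) = holesV ts

    holesV : {n : ℕ} → Vec Ctx n → ℕ
    holesV []       = 0
    holesV (t ∷ ts) = holes t Data.Nat.+ holesV ts

  IsContext : Ctx → Set
  IsContext c = holes c ≡ 1

  plug : Ctx → Tree → Tree
  plug c t = bind (λ _ → t) c

  compose : Ctx → Ctx → Ctx
  compose c' c = bind (λ _ → c) c'

  embed : Tree → Ctx
  embed = bind (λ ())

  InΣ : List Tree → Tree → Set
  InΣ T s = ∃[ σ ] Σ (Vec Tree (arity σ)) λ ts → All (_∈ T) ts × s ≡ node σ ts

  InΣwith : List Tree → Tree → Tree → Set
  InΣwith T t s = ∃[ σ ] Σ (Vec Tree (arity σ)) λ ts →
    All (_∈ T) ts × Any (t ≡_) ts × s ≡ node σ ts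

  InΣ◇ : List Tree → Ctx → Set
  InΣ◇ T c = ∃[ σ ] Σ (Vec Ctx (arity σ)) λ cs → Σ (Fin (arity σ)) λ p →
    lookup cs p ≡ ◇ ×
    (∀ q → q ≢ p → ∃[ t ] (t ∈ T × lookup cs q ≡ embed t)) ×
    c ≡ node σ cs

module Learning {c ℓ₁ ℓ₂ : Level} (Σ' : RankedAlphabet)
                (K : HeytingField c ℓ₁ ℓ₂) where
  open RankedAlphabet Σ'
  open Trees Σ'
  open HeytingField K using (Carrier; _≈_; _+_; _*_; 0#; 1#)

  ∑ : (n : ℕ) → (Fin n → Carrier) → Carrier
  ∑ zero    f = 0#
  ∑ (suc n) f = f zero + ∑ n (λ i → f (suc i))

  -- multiplicity tree automaton (Σ, K, d, μ, λ):
  -- μ σ i (j₁ ∷ … ∷ j_k ∷ []) is the coefficient μ_σ^i_{j₁…j_k}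
  record MTA (d : ℕ) : Set c where
    field
      λv : Fin d → Carrier
      μ  : (σ : Sym) → Fin d → Vec (Fin d) (arity σ) → Carrier

  multi : {d k : ℕ} → (Vec (Fin d) k → Carrier) → Vec (Fin d → Carrier) k → Carrier
  multi {d} f []       = f []
  multi {d} f (v ∷ vs) = ∑ d (λ j → v j * multi (λ js → f (j ∷ js)) vs)

  module _ {d : ℕ} (A : MTA d) where
    open MTA A
    mutual
      μ̂ : Tree → Fin d → Carrier
      μ̂ (var ())
      μ̂ (node σ ts) i = multi (μ σ i) (μ̂V ts)

      μ̂V : {n : ℕ} → Vec Tree n → Vec (Fin d → Carrier) n
      μ̂V []       = []
      μ̂V (t ∷ ts) = μ̂ t ∷ μ̂V ts

    ⟦_⟧ : Tree → Carrier
    ⟦ t ⟧ = ∑ d (λ j → λv j * μ̂ t j)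

  -- An observation table (T, C, H, B); H is given by H[t][c] = 𝒯(c[t]).
  record Table : Set where
    field
      T : List Tree
      C : List Ctx
      d : ℕ
      b : Fin d → Tree

  module _ (𝒯 : Tree → Carrier) (tbl : Table) where
    open Table tbl

    H : Tree → Ctx → Carrier
    H t c' = 𝒯 (plug c' t)

    ZeroRow : Tree → Set (ℓ₁)
    ZeroRow t = ∀ c' → c' ∈ C → H t c' ≈ 0#

    CoLin : Carrier → Tree → Tree → Set (ℓ₁)
    CoLin α t₁ t₂ = ¬ (α ≈ 0#) × (∀ c' → c' ∈ C → H t₁ c' ≈ α * H t₂ c')

    record LearnInvariants : Set (c ⊔ ℓ₁) where
      field
        T-subtree-closed : ∀ σ ts → node σ ts ∈ T → All (_∈ T) ts
        C-contexts       : ∀ c' → c' ∈ C → IsContext c'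
        ◇∈C              : ◇ ∈ C
        C-built          : ∀ c' → c' ∈ C →
                             c' ≡ ◇ ⊎ ∃[ c₁ ] ∃[ c₂ ] (c₁ ∈ C × InΣ◇ T c₂ × c' ≡ compose c₁ c₂)
        B⊆T              : ∀ j → b j ∈ T
        B-nonzero        : ∀ j → ¬ ZeroRow (b j)
        B-non-colinear   : ∀ i j → i ≢ j → ∀ α → ¬ CoLin α (b i) (b j)
        B-children       : ∀ j σ ts → b j ≡ node σ ts → All (λ s → ∃[ k ] s ≡ b k) ts

    Closed : Set (c ⊔ ℓ₁)
    Closed = ∀ s → InΣ T s → ZeroRow s ⊎ ∃[ j ] ∃[ α ] CoLin α s (b j)

    ZeroConsistent : Set (ℓ₁)
    ZeroConsistent = ∀ t → t ∈ T → ZeroRow t →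
      ∀ t' → InΣwith T t t' → ∀ c' → c' ∈ C → H t' c' ≈ 0#

    CoLinConsistent : Set (c ⊔ ℓ₁)
    CoLinConsistent = ∀ t₁ t₂ → t₁ ∈ T → t₂ ∈ T → ∀ α → CoLin α t₁ t₂ →
      ∀ c' → InΣ◇ T c' → CoLin α (plug c' t₁) (plug c' t₂)

    Consistent : Set (c ⊔ ℓ₁)
    Consistent = ZeroConsistent × CoLinConsistent

    IsExtracted : MTA d → Set (c ⊔ ℓ₁)
    IsExtracted A =
      (∀ j → λv j ≈ H (b j) ◇) ×
      (∀ σ (is : Vec (Fin d) (arity σ)) →
        let t = node σ (Vec.map b is) in
        (ZeroRow t → ∀ j → μ σ j is ≈ 0#) ×
        (¬ ZeroRow t → ∀ i α → CoLin α t (b i) →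
            μ σ i is ≈ α × (∀ j → j ≢ i → μ σ j is ≈ 0#)))
      where open MTA A

{-# OPTIONS --safe #-}
module Submission where

-- Every tree s of T ∪ Σ(T) is well represented by the extracted automaton: either its row is
-- zero and μ(s) = 0, or s ≡^α_H b_i and μ(s) = α e_i.  This goes by induction on s: a node
-- with a zero child is zero by zero-consistency (and μ vanishes by multilinearity); otherwise
-- co-linear consistency, applied one child at a time, gives σ(t₁,…,t_k) ≡^(∏α_j) σ(b_{i₁},…,b_{i_k}),
-- and closedness with the definition of ExtractCMTA settles the latter.  In particular μ(b_i) = e_i.
-- A context acts linearly on μ, so 𝒜(c[s]) = α 𝒜(c[b_i]) = α H[b_i][c] = H[s][c] as soon as
-- 𝒜(c[b_i]) = H[b_i][c].  Every column other than ◇ is c₁[c₂] with c₁ ∈ C smaller and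
-- c₂[t] ∈ Σ(T), so induction on the size of the column proves the theorem.

open import Defs
open import Level using (Level; _⊔_)
open import Data.Product using (_×_; ∃₂; _,_; proj₁; proj₂)
open import Data.List.Membership.Propositional using (_∈_)
open import Algebra.Apartness.Bundles using (HeytingField; HeytingCommutativeRing)
open import Algebra.Bundles using (CommutativeRing)
open import Data.Nat as ℕ using (ℕ; zero; suc; _<_)
import Data.Nat.Properties as ℕ
open import Data.Nat.Induction using (<-wellFounded)
open import Data.Nat.Tactic.RingSolver using (solve-∀)
open import Induction.WellFounded using (Acc; acc)
open import Data.Fin using (Fin; zero; suc; _≟_)
import Data.Fin.Properties as Fin
open import Data.Vec using (Vec; []; _∷_; lookup; _[_]≔_)
import Data.Vec as Vec
open import Data.Vec.Properties using (lookup-map; map-[]≔; map-∘; []≔-lookup; lookup∘updateAt; lookup∘updateAt′)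
open import Data.Vec.Relation.Unary.All using (All; []; _∷_)
import Data.Vec.Relation.Unary.All as All
import Data.Vec.Relation.Unary.All.Properties as All
open import Data.Vec.Relation.Unary.Any using (Any; here; there)
import Data.Vec.Relation.Unary.Any as Any
import Data.Vec.Relation.Unary.Any.Properties as Any
open import Data.Vec.Membership.Propositional.Properties using (∈-lookup)
open import Data.Sum using (_⊎_; inj₁; inj₂)
open import Data.Empty using (⊥)
open import Data.Unit using (⊤)
open import Function using (const; _∘_)
open import Relation.Nullary using (¬_; yes; no; contradiction)
open import Relation.Binary.PropositionalEquality as ≡ using (_≡_; _≢_)

m+n≡1⇒m≡1∧n≡0∨m≡0∧n≡1 : ∀ m {n} → m ℕ.+ n ≡ 1 → (m ≡ 1 × n ≡ 0) ⊎ (m ≡ 0 × n ≡ 1)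
m+n≡1⇒m≡1∧n≡0∨m≡0∧n≡1 zero          eq = inj₂ (≡.refl , eq)
m+n≡1⇒m≡1∧n≡0∨m≡0∧n≡1 (suc zero)    eq = inj₁ (≡.refl , ℕ.suc-injective eq)
m+n≡1⇒m≡1∧n≡0∨m≡0∧n≡1 (suc (suc m)) ()

module Substitution (Σ' : RankedAlphabet) where
  open RankedAlphabet Σ'
  open Trees Σ'

  mutual
    bind-bind : ∀ {X Y Z : Set} (f : Y → Tr Z) (g : X → Tr Y) (t : Tr X) →
                bind f (bind g t) ≡ bind (bind f ∘ g) t
    bind-bind f g (var x)     = ≡.refl
    bind-bind f g (node σ ts) = ≡.cong (node σ) (bindV-bind f g ts)

    bindV-bind : ∀ {X Y Z : Set} {n} (f : Y → Tr Z) (g : X → Tr Y) (ts : Vec (Tr X) n) →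
                 bindV f (bindV g ts) ≡ bindV (bind f ∘ g) ts
    bindV-bind f g []       = ≡.refl
    bindV-bind f g (t ∷ ts) = ≡.cong₂ _∷_ (bind-bind f g t) (bindV-bind f g ts)

  mutual
    bind-tree : (f : ⊥ → Tree) (t : Tree) → bind f t ≡ t
    bind-tree f (node σ ts) = ≡.cong (node σ) (bindV-tree f ts)

    bindV-tree : ∀ {n} (f : ⊥ → Tree) (ts : Vec Tree n) → bindV f ts ≡ ts
    bindV-tree f []       = ≡.refl
    bindV-tree f (t ∷ ts) = ≡.cong₂ _∷_ (bind-tree f t) (bindV-tree f ts)

  bindV≡map : ∀ {X Y : Set} {n} (f : X → Tr Y) (ts : Vec (Tr X) n) → bindV f ts ≡ Vec.map (bind f) ts
  bindV≡map f []       = ≡.refl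
  bindV≡map f (t ∷ ts) = ≡.cong (bind f t ∷_) (bindV≡map f ts)

  mutual
    bind-holeFree : ∀ {B : Set} (c : Ctx) (f g : ⊤ → Tr B) → holes c ≡ 0 → bind f c ≡ bind g c
    bind-holeFree (node σ cs) f g h = ≡.cong (node σ) (bindV-holeFree cs f g h)

    bindV-holeFree : ∀ {B : Set} {n} (cs : Vec Ctx n) (f g : ⊤ → Tr B) → holesV cs ≡ 0 →
                     bindV f cs ≡ bindV g cs
    bindV-holeFree []       f g h = ≡.refl
    bindV-holeFree (c ∷ cs) f g h =
      ≡.cong₂ _∷_ (bind-holeFree c f g (ℕ.m+n≡0⇒m≡0 (holes c) h))
                  (bindV-holeFree cs f g (ℕ.m+n≡0⇒n≡0 (holes c) h))

  plug-embed : ∀ t u → plug (embed t) u ≡ t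
  plug-embed t u = ≡.trans (bind-bind (const u) (λ ()) t) (bind-tree _ t)

  plug-compose : ∀ c₁ c₂ t → plug (compose c₁ c₂) t ≡ plug c₁ (plug c₂ t)
  plug-compose c₁ c₂ t = bind-bind (const t) (const c₂) c₁

  mutual
    size : Ctx → ℕ
    size (var _)     = 0
    size (node σ cs) = suc (sizeV cs)

    sizeV : ∀ {n} → Vec Ctx n → ℕ
    sizeV []       = 0
    sizeV (c ∷ cs) = size c ℕ.+ sizeV cs

  mutual
    size-compose : ∀ c k → size (compose c k) ≡ size c ℕ.+ holes c ℕ.* size k
    size-compose (var _)     k = ≡.sym (ℕ.+-identityʳ (size k))
    size-compose (node σ cs) k = ≡.cong suc (sizeV-compose cs k)

    sizeV-compose : ∀ {n} (cs : Vec Ctx n) k →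
                    sizeV (bindV (const k) cs) ≡ sizeV cs ℕ.+ holesV cs ℕ.* size k
    sizeV-compose []       k = ≡.refl
    sizeV-compose (c ∷ cs) k
      rewrite size-compose c k | sizeV-compose cs k = regroup (size c) (sizeV cs) (holes c) (holesV cs) (size k)
      where
      regroup : ∀ a b h h′ s → (a ℕ.+ h ℕ.* s) ℕ.+ (b ℕ.+ h′ ℕ.* s) ≡ (a ℕ.+ b) ℕ.+ (h ℕ.+ h′) ℕ.* s
      regroup = solve-∀

  size<size-compose : ∀ {T} c₁ c₂ → IsContext c₁ → InΣ◇ T c₂ → size c₁ < size (compose c₁ c₂)
  size<size-compose c₁ (node σ cs) isCtx _ rewrite size-compose c₁ (node σ cs) | isCtx =
    ℕ.m<m+n (size c₁) (ℕ.s≤s ℕ.z≤n)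

  holeAt : ∀ {n} → Vec Tree n → Fin n → Vec Ctx n
  holeAt ts p = Vec.map embed ts [ p ]≔ ◇

  plug-holeAt : ∀ σ (ts : Vec Tree (arity σ)) p u → plug (node σ (holeAt ts p)) u ≡ node σ (ts [ p ]≔ u)
  plug-holeAt σ ts p u = ≡.cong (node σ) (begin
    bindV (const u) (Vec.map embed ts [ p ]≔ ◇)          ≡⟨ bindV≡map (const u) _ ⟩
    Vec.map (λ c → plug c u) (Vec.map embed ts [ p ]≔ ◇) ≡⟨ map-[]≔ (λ c → plug c u) (Vec.map embed ts) p ⟩
    Vec.map (λ c → plug c u) (Vec.map embed ts) [ p ]≔ u ≡⟨ ≡.cong (_[ p ]≔ u) (≡.sym (map-∘ _ embed ts)) ⟩
    Vec.map (λ t → plug (embed t) u) ts [ p ]≔ u         ≡⟨ ≡.cong (_[ p ]≔ u) (map-plug-embed ts) ⟩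
    ts [ p ]≔ u                                          ∎)
    where
    open ≡.≡-Reasoning
    map-plug-embed : ∀ {n} (xs : Vec Tree n) → Vec.map (λ t → plug (embed t) u) xs ≡ xs
    map-plug-embed []       = ≡.refl
    map-plug-embed (x ∷ xs) = ≡.cong₂ _∷_ (plug-embed x u) (map-plug-embed xs)

  holeAt∈Σ◇ : ∀ {T} σ {ts : Vec Tree (arity σ)} → All (_∈ T) ts → ∀ p → InΣ◇ T (node σ (holeAt ts p))
  holeAt∈Σ◇ σ {ts} ts∈T p =
    σ , holeAt ts p , p , lookup∘updateAt p (Vec.map embed ts) ,
    (λ q q≢p → lookup ts q , All.lookup⁺ ts∈T q ,
               ≡.trans (lookup∘updateAt′ q p q≢p (Vec.map embed ts)) (lookup-map q embed ts)) ,
    ≡.refl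

  plug∈Σ : ∀ {T c t} → InΣ◇ T c → t ∈ T → InΣ T (plug c t)
  plug∈Σ {T} {t = t} (σ , cs , p , cs[p]≡◇ , others∈T , ≡.refl) t∈T =
    σ , bindV (const t) cs , All.lookup⁻ child∈T , ≡.refl
    where
    child∈T : ∀ q → lookup (bindV (const t) cs) q ∈ T
    child∈T q rewrite bindV≡map (const t) cs | lookup-map q (λ c → plug c t) cs with q ≟ p
    ... | yes ≡.refl rewrite cs[p]≡◇ = t∈T
    ... | no q≢p with others∈T q q≢p
    ...   | s , s∈T , cs[q]≡s rewrite cs[q]≡s | plug-embed s t = s∈T

module HeytingFieldProperties {c ℓ₁ ℓ₂ : Level} (K : HeytingField c ℓ₁ ℓ₂) where
  open HeytingField K hiding (zero)
  open CommutativeRing (HeytingCommutativeRing.commutativeRing heytingCommutativeRing) using (ring)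
  open import Algebra.Apartness.Properties.HeytingCommutativeRing heytingCommutativeRing
    using (1#0; x#0y#0→xy#0; #-congʳ)
  open import Algebra.Properties.Ring ring using (-1*x≈-x)
  open import Relation.Binary.Reasoning.Setoid setoid

  1≉0 : ¬ 1# ≈ 0#
  1≉0 1≈0 = #-irrefl 1≈0 1#0

  *-cancelˡ-≉0 : ∀ {α x} → ¬ α ≈ 0# → α * x ≈ 0# → x ≈ 0#
  *-cancelˡ-≉0 {α} {x} α≉0 αx≈0 = proj₁ (tight x 0#) λ x#0 →
    α≉0 (proj₁ (tight α 0#) λ α#0 → #-irrefl refl (#-congʳ αx≈0 (x#0y#0→xy#0 α#0 x#0)))

  x≈αx∧α#1⇒x≈0 : ∀ {α x} → α # 1# → x ≈ α * x → x ≈ 0#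
  x≈αx∧α#1⇒x≈0 {α} {x} α#1 x≈αx with #⇒invertible α#1
  ... | u , u[α-1]≈1 , _ = begin
    x                  ≈⟨ *-identityˡ x ⟨
    1# * x             ≈⟨ *-congʳ u[α-1]≈1 ⟨
    (u * (α - 1#)) * x ≈⟨ *-assoc u (α - 1#) x ⟩
    u * ((α - 1#) * x) ≈⟨ *-congˡ [α-1]x≈0 ⟩
    u * 0#             ≈⟨ zeroʳ u ⟩
    0#                 ∎
    where
    [α-1]x≈0 : (α - 1#) * x ≈ 0#
    [α-1]x≈0 = begin
      (α - 1#) * x        ≈⟨ distribʳ x α (- 1#) ⟩
      α * x + (- 1#) * x  ≈⟨ +-cong (sym x≈αx) (-1*x≈-x x) ⟩
      x - x               ≈⟨ -‿inverseʳ x ⟩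
      0#                  ∎

module MultilinearAlgebra {c ℓ₁ ℓ₂ : Level} (Σ' : RankedAlphabet) (K : HeytingField c ℓ₁ ℓ₂) where
  open Learning Σ' K
  open HeytingField K hiding (zero)
  open CommutativeRing (HeytingCommutativeRing.commutativeRing heytingCommutativeRing)
    using (*-commutativeSemigroup)
  open import Algebra.Properties.CommutativeSemigroup *-commutativeSemigroup
    using (x∙yz≈y∙xz)

  IsZero : ∀ {d} → (Fin d → Carrier) → Set ℓ₁
  IsZero v = ∀ j → v j ≈ 0#

  ScaledUnit : ∀ {d} → Carrier → Fin d → (Fin d → Carrier) → Set ℓ₁
  ScaledUnit α i v = v i ≈ α × (∀ j → j ≢ i → v j ≈ 0#)

  ScaledUnit-scale : ∀ {d} {γ β} {i : Fin d} {v w} → (∀ j → v j ≈ γ * w j) →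
                     ScaledUnit β i w → ScaledUnit (γ * β) i v
  ScaledUnit-scale v≈γw (wi≈β , w≈0) =
    trans (v≈γw _) (*-congˡ wi≈β) , λ j j≢i → trans (v≈γw j) (trans (*-congˡ (w≈0 j j≢i)) (zeroʳ _))

  ScaledUnit⇒≈ : ∀ {d} {α} {i : Fin d} {v w} → ScaledUnit α i v → ScaledUnit 1# i w → ∀ j → v j ≈ α * w j
  ScaledUnit⇒≈ {i = i} (vi≈α , v≈0) (wi≈1 , w≈0) j with j ≟ i
  ... | yes ≡.refl = trans vi≈α (trans (sym (*-identityʳ _)) (*-congˡ (sym wi≈1)))
  ... | no j≢i     = trans (v≈0 j j≢i) (trans (sym (zeroʳ _)) (*-congˡ (sym (w≈0 j j≢i))))

  ∑-zero : ∀ n {f : Fin n → Carrier} → IsZero f → ∑ n f ≈ 0#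
  ∑-zero zero    f≈0 = refl
  ∑-zero (suc n) f≈0 = trans (+-cong (f≈0 zero) (∑-zero n (f≈0 ∘ suc))) (+-identityʳ 0#)

  ∑-delta : ∀ n {f : Fin n → Carrier} i → (∀ j → j ≢ i → f j ≈ 0#) → ∑ n f ≈ f i
  ∑-delta (suc n) zero    f≈0 =
    trans (+-congˡ (∑-zero n (λ j → f≈0 (suc j) λ ()))) (+-identityʳ _)
  ∑-delta (suc n) (suc i) f≈0 =
    trans (+-cong (f≈0 zero λ ()) (∑-delta n i (λ j j≢i → f≈0 (suc j) (j≢i ∘ Fin.suc-injective))))
          (+-identityˡ _)

  ∑-linear : ∀ n {α} {f g : Fin n → Carrier} → (∀ j → f j ≈ α * g j) → ∑ n f ≈ α * ∑ n g
  ∑-linear zero    {α} f≈αg = sym (zeroʳ α)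
  ∑-linear (suc n) {α} f≈αg =
    trans (+-cong (f≈αg zero) (∑-linear n (f≈αg ∘ suc))) (sym (distribˡ α _ _))

  multi-zero : ∀ {d k} (f : Vec (Fin d) k → Carrier) {vs} → Any IsZero vs → multi f vs ≈ 0#
  multi-zero {d} f (here v≈0)  = ∑-zero d λ j → trans (*-congʳ (v≈0 j)) (zeroˡ _)
  multi-zero {d} f {v ∷ _} (there any) = ∑-zero d λ j → trans (*-congˡ (multi-zero _ any)) (zeroʳ (v j))

  prod : ∀ {n} → Vec Carrier n → Carrier
  prod []       = 1#
  prod (a ∷ as) = a * prod as

  data ScaledUnits {d} : ∀ {n} → Vec (Fin d → Carrier) n → Vec (Fin d) n → Vec Carrier n → Set (c ⊔ ℓ₁) where
    []  : ScaledUnits [] [] []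
    _∷_ : ∀ {n v i a} {vs : Vec _ n} {is as} →
          ScaledUnit a i v → ScaledUnits vs is as → ScaledUnits (v ∷ vs) (i ∷ is) (a ∷ as)

  multi-scaledUnits : ∀ {d k} (f : Vec (Fin d) k → Carrier) {vs is as} →
                      ScaledUnits vs is as → multi f vs ≈ prod as * f is
  multi-scaledUnits f [] = sym (*-identityˡ _)
  multi-scaledUnits {d} f {v ∷ vs} {i ∷ is} {a ∷ as} ((vi≈a , v≈0) ∷ units) =
    trans (∑-delta d i λ j j≢i → trans (*-congʳ (v≈0 j j≢i)) (zeroˡ _))
   (trans (*-cong vi≈a (multi-scaledUnits (λ js → f (i ∷ js)) units))
          (sym (*-assoc a (prod as) (f (i ∷ is)))))

  data Rescaled {d} (α : Carrier) : ∀ {k} → Vec (Fin d → Carrier) k → Vec (Fin d → Carrier) k → Set (c ⊔ ℓ₁) where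
    rescale-here  : ∀ {k v v′} {vs : Vec _ k} → (∀ j → v j ≈ α * v′ j) → Rescaled α (v ∷ vs) (v′ ∷ vs)
    rescale-there : ∀ {k v} {vs vs′ : Vec _ k} → Rescaled α vs vs′ → Rescaled α (v ∷ vs) (v ∷ vs′)

  multi-rescaled : ∀ {d k α} (f : Vec (Fin d) k → Carrier) {vs vs′} → Rescaled α vs vs′ →
                   multi f vs ≈ α * multi f vs′
  multi-rescaled {d} {α = α} f (rescale-here v≈αv′) =
    ∑-linear d λ j → trans (*-congʳ (v≈αv′ j)) (*-assoc α _ _)
  multi-rescaled {d} {α = α} f {v ∷ _} (rescale-there rescaled) =
    ∑-linear d λ j → trans (*-congˡ (multi-rescaled _ rescaled)) (x∙yz≈y∙xz (v j) α _)

module ContextLinearity {c ℓ₁ ℓ₂ : Level} (Σ' : RankedAlphabet) (K : HeytingField c ℓ₁ ℓ₂)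
                        {d : ℕ} (A : Learning.MTA Σ' K d) where
  open Trees Σ'
  open Learning Σ' K
  open HeytingField K hiding (zero)
  open CommutativeRing (HeytingCommutativeRing.commutativeRing heytingCommutativeRing)
    using (*-commutativeSemigroup)
  open MTA A
  open Substitution Σ'
  open MultilinearAlgebra Σ' K
  open import Algebra.Properties.CommutativeSemigroup *-commutativeSemigroup
    using (x∙yz≈y∙xz)

  μ̂V≡map : ∀ {n} (ts : Vec Tree n) → μ̂V A ts ≡ Vec.map (μ̂ A) ts
  μ̂V≡map []       = ≡.refl
  μ̂V≡map (t ∷ ts) = ≡.cong (μ̂ A t ∷_) (μ̂V≡map ts)

  mutual
    μ̂-plug-scale : ∀ (ctx : Ctx) → IsContext ctx → ∀ {α s s′} → (∀ j → μ̂ A s j ≈ α * μ̂ A s′ j) →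
                   ∀ j → μ̂ A (plug ctx s) j ≈ α * μ̂ A (plug ctx s′) j
    μ̂-plug-scale (var _)     _      s≈αs′ j = s≈αs′ j
    μ̂-plug-scale (node σ cs) isCtx s≈αs′ j = multi-rescaled (μ σ j) (μ̂V-plug-rescaled cs isCtx s≈αs′)

    μ̂V-plug-rescaled : ∀ {n} (cs : Vec Ctx n) → holesV cs ≡ 1 → ∀ {α s s′} →
                       (∀ j → μ̂ A s j ≈ α * μ̂ A s′ j) →
                       Rescaled α (μ̂V A (bindV (const s) cs)) (μ̂V A (bindV (const s′) cs))
    μ̂V-plug-rescaled (ctx ∷ cs) h {α} {s} {s′} s≈αs′ with m+n≡1⇒m≡1∧n≡0∨m≡0∧n≡1 (holes ctx) h
    ... | inj₁ (ctx-1 , cs-0) rewrite bindV-holeFree cs (const s) (const s′) cs-0 =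
      rescale-here (μ̂-plug-scale ctx ctx-1 s≈αs′)
    ... | inj₂ (ctx-0 , cs-1) rewrite bind-holeFree ctx (const s) (const s′) ctx-0 =
      rescale-there (μ̂V-plug-rescaled cs cs-1 s≈αs′)

  ⟦⟧-plug-scale : ∀ ctx → IsContext ctx → ∀ {α s s′} → (∀ j → μ̂ A s j ≈ α * μ̂ A s′ j) →
                  ⟦ A ⟧ (plug ctx s) ≈ α * ⟦ A ⟧ (plug ctx s′)
  ⟦⟧-plug-scale ctx isCtx {α} s≈αs′ =
    ∑-linear d λ j → trans (*-congˡ (μ̂-plug-scale ctx isCtx s≈αs′ j)) (x∙yz≈y∙xz (λv j) α _)

module ExtractedAutomaton {c ℓ₁ ℓ₂ : Level} (Σ' : RankedAlphabet) (K : HeytingField c ℓ₁ ℓ₂)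
  (𝒯 : Trees.Tree Σ' → HeytingField.Carrier K) (tbl : Learning.Table Σ' K)
  (inv : Learning.LearnInvariants Σ' K 𝒯 tbl)
  (closed : Learning.Closed Σ' K 𝒯 tbl)
  (consistent : Learning.Consistent Σ' K 𝒯 tbl)
  (A : Learning.MTA Σ' K (Learning.Table.d tbl))
  (extracted : Learning.IsExtracted Σ' K 𝒯 tbl A) where
  open RankedAlphabet Σ'
  open Trees Σ'
  open Learning Σ' K hiding (H; ZeroRow; CoLin)
  open HeytingField K hiding (zero)
  open Table tbl
  open LearnInvariants inv
  open MTA A
  open Substitution Σ'
  open HeytingFieldProperties K
  open MultilinearAlgebra Σ' K
  open ContextLinearity Σ' K A
  open import Relation.Binary.Reasoning.Setoid setoid

  H : Tree → Ctx → Carrier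
  H = Learning.H Σ' K 𝒯 tbl

  ZeroRow : Tree → Set ℓ₁
  ZeroRow = Learning.ZeroRow Σ' K 𝒯 tbl

  CoLin : Carrier → Tree → Tree → Set ℓ₁
  CoLin = Learning.CoLin Σ' K 𝒯 tbl

  CoLin-refl : ∀ t → CoLin 1# t t
  CoLin-refl t = 1≉0 , λ _ _ → sym (*-identityˡ _)

  CoLin-trans : ∀ {α β r s t} → CoLin α r s → CoLin β s t → CoLin (α * β) r t
  CoLin-trans {α} {β} (α≉0 , r≈αs) (β≉0 , s≈βt) =
    β≉0 ∘ *-cancelˡ-≉0 α≉0 ,
    λ c′ c′∈C → trans (r≈αs c′ c′∈C) (trans (*-congˡ (s≈βt c′ c′∈C)) (sym (*-assoc α β _)))

  CoLin-zeroRow : ∀ {α s t} → CoLin α s t → ZeroRow t → ZeroRow s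
  CoLin-zeroRow (_ , s≈αt) t≈0 c′ c′∈C = trans (s≈αt c′ c′∈C) (trans (*-congˡ (t≈0 c′ c′∈C)) (zeroʳ _))

  CoLin-b⇒¬ZeroRow : ∀ {β s i} → CoLin β s (b i) → ¬ ZeroRow s
  CoLin-b⇒¬ZeroRow {i = i} (β≉0 , s≈βb) s≈0 =
    B-nonzero i λ c′ c′∈C → *-cancelˡ-≉0 β≉0 (trans (sym (s≈βb c′ c′∈C)) (s≈0 c′ c′∈C))

  RespectsCoLin : ∀ {n} → (Vec Tree n → Tree) → Set (c ⊔ ℓ₁)
  RespectsCoLin F = ∀ {ts} → All (_∈ T) ts → ∀ p {u} → u ∈ T → ∀ {α} →
                    CoLin α (lookup ts p) u → CoLin α (F ts) (F (ts [ p ]≔ u))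

  node-respectsCoLin : ∀ σ → RespectsCoLin (node σ)
  node-respectsCoLin σ {ts} ts∈T p {u} u∈T ts[p]≡u =
    ≡.subst₂ (CoLin _)
      (≡.trans (plug-holeAt σ ts p (lookup ts p)) (≡.cong (node σ) ([]≔-lookup ts p)))
      (plug-holeAt σ ts p u)
      (proj₂ consistent _ u (All.lookup⁺ ts∈T p) u∈T _ ts[p]≡u _ (holeAt∈Σ◇ σ ts∈T p))

  data CoLinWise : ∀ {n} → Vec Carrier n → Vec Tree n → Vec Tree n → Set (c ⊔ ℓ₁) where
    []  : CoLinWise [] [] []
    _∷_ : ∀ {n a t w} {as : Vec Carrier n} {ts ws} →
          CoLin a t w → CoLinWise as ts ws → CoLinWise (a ∷ as) (t ∷ ts) (w ∷ ws)

  CoLinWise⇒CoLin : ∀ {n} {F : Vec Tree n → Tree} → RespectsCoLin F → ∀ {as ts ws} →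
                    All (_∈ T) ts → All (_∈ T) ws → CoLinWise as ts ws → CoLin (prod as) (F ts) (F ws)
  CoLinWise⇒CoLin {F = F} F-respects [] [] [] = CoLin-refl (F [])
  CoLinWise⇒CoLin F-respects (t∈T ∷ ts∈T) (w∈T ∷ ws∈T) (t≡w ∷ ts≡ws) =
    CoLin-trans (F-respects (t∈T ∷ ts∈T) zero w∈T t≡w)
                (CoLinWise⇒CoLin (λ xs∈T p → F-respects (w∈T ∷ xs∈T) (suc p)) ts∈T ws∈T ts≡ws)

  map-b∈T : ∀ {n} (is : Vec (Fin d) n) → All (_∈ T) (Vec.map b is)
  map-b∈T is = All.map⁺ (All.universal B⊆T is)

  Vanishing : Tree → Set ℓ₁
  Vanishing s = ZeroRow s × IsZero (μ̂ A s)

  data WellRepresented (s : Tree) : Set (c ⊔ ℓ₁) where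
    vanishing : Vanishing s → WellRepresented s
    colinear  : ∀ i α → CoLin α s (b i) → ScaledUnit α i (μ̂ A s) → WellRepresented s

  children-vanishing-or-colinear : ∀ {n} {ts : Vec Tree n} → All WellRepresented ts →
    Any Vanishing ts ⊎ ∃₂ λ is as → CoLinWise as ts (Vec.map b is) × ScaledUnits (μ̂V A ts) is as
  children-vanishing-or-colinear [] = inj₂ ([] , [] , [] , [])
  children-vanishing-or-colinear (vanishing v ∷ _) = inj₁ (here v)
  children-vanishing-or-colinear (colinear i α t≡b unit ∷ reps) with children-vanishing-or-colinear reps
  ... | inj₁ any                       = inj₁ (there any)
  ... | inj₂ (is , as , ts≡bs , units) = inj₂ (i ∷ is , α ∷ as , t≡b ∷ ts≡bs , unit ∷ units)

  node-vanishing : ∀ σ {ts : Vec Tree (arity σ)} → All (_∈ T) ts → Any Vanishing ts → Vanishing (node σ ts)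
  node-vanishing σ {ts} ts∈T any =
    (λ c′ c′∈C → proj₁ consistent child (All.lookup⁺ ts∈T k) (proj₁ child-vanishing)
                   (node σ ts) (σ , ts , ts∈T , ∈-lookup k ts , ≡.refl) c′ c′∈C) ,
    (λ j → multi-zero (μ σ j) (≡.subst (Any IsZero) (≡.sym (μ̂V≡map ts)) (Any.map⁺ (Any.map proj₂ any))))
    where
    k = Any.index any
    child = lookup ts k
    child-vanishing : Vanishing child
    child-vanishing = Any.lookup-index any

  representative-wellRepresented : ∀ σ is {γ s} → CoLin γ s (node σ (Vec.map b is)) →
                                   (∀ j → μ̂ A s j ≈ γ * μ σ j is) → WellRepresented s
  representative-wellRepresented σ is s≡bs μs≈γμ
    with closed (node σ (Vec.map b is)) (σ , Vec.map b is , map-b∈T is , ≡.refl)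
  ... | inj₁ bs-zero = vanishing (CoLin-zeroRow s≡bs bs-zero ,
          λ j → trans (μs≈γμ j) (trans (*-congˡ (proj₁ (proj₂ extracted σ is) bs-zero j)) (zeroʳ _)))
  ... | inj₂ (i , β , bs≡b) = colinear i _ (CoLin-trans s≡bs bs≡b)
          (ScaledUnit-scale μs≈γμ (proj₂ (proj₂ extracted σ is) (CoLin-b⇒¬ZeroRow bs≡b) i β bs≡b))

  node-wellRepresented : ∀ σ {ts} → All (_∈ T) ts → All WellRepresented ts → WellRepresented (node σ ts)
  node-wellRepresented σ ts∈T reps with children-vanishing-or-colinear reps
  ... | inj₁ any = vanishing (node-vanishing σ ts∈T any)
  ... | inj₂ (is , as , ts≡bs , units) =
    representative-wellRepresented σ is
      (CoLinWise⇒CoLin (node-respectsCoLin σ) ts∈T (map-b∈T is) ts≡bs)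
      (λ j → multi-scaledUnits (μ σ j) units)

  mutual
    T-wellRepresented : ∀ t → t ∈ T → WellRepresented t
    T-wellRepresented (node σ ts) t∈T = node-wellRepresented σ ts∈T (All-T-wellRepresented ts ts∈T)
      where ts∈T = T-subtree-closed σ ts t∈T

    All-T-wellRepresented : ∀ {n} (ts : Vec Tree n) → All (_∈ T) ts → All WellRepresented ts
    All-T-wellRepresented []       []           = []
    All-T-wellRepresented (t ∷ ts) (t∈T ∷ ts∈T) = T-wellRepresented t t∈T ∷ All-T-wellRepresented ts ts∈T

  ΣT-wellRepresented : ∀ s → InΣ T s → WellRepresented s
  ΣT-wellRepresented _ (σ , ts , ts∈T , ≡.refl) = node-wellRepresented σ ts∈T (All-T-wellRepresented ts ts∈T)

  b-unit : ∀ i → ScaledUnit 1# i (μ̂ A (b i))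
  b-unit i with T-wellRepresented (b i) (B⊆T i)
  ... | vanishing (b-zero , _) = contradiction b-zero (B-nonzero i)
  ... | colinear i′ α b≡b′ unit with i ≟ i′
  ...   | no i≢i′    = contradiction b≡b′ (B-non-colinear i i′ i≢i′ α)
  ...   | yes ≡.refl = trans (proj₁ unit) α≈1 , proj₂ unit
    where
    α≈1 : α ≈ 1#
    α≈1 = proj₁ (tight α 1#) λ α#1 → B-nonzero i λ c′ c′∈C → x≈αx∧α#1⇒x≈0 α#1 (proj₂ b≡b′ c′ c′∈C)

  ⟦b⟧≈H : ∀ i → ⟦ A ⟧ (b i) ≈ H (b i) ◇
  ⟦b⟧≈H i = begin
    ⟦ A ⟧ (b i)        ≈⟨ ∑-delta d i (λ j j≢i → trans (*-congˡ (proj₂ (b-unit i) j j≢i)) (zeroʳ _)) ⟩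
    λv i * μ̂ A (b i) i ≈⟨ *-congˡ (proj₁ (b-unit i)) ⟩
    λv i * 1#          ≈⟨ *-identityʳ _ ⟩
    λv i               ≈⟨ proj₁ extracted i ⟩
    H (b i) ◇          ∎

  ⟦⟧-agrees-wellRepresented : ∀ {c′ s} → c′ ∈ C → WellRepresented s →
                              (∀ i → ⟦ A ⟧ (plug c′ (b i)) ≈ H (b i) c′) → ⟦ A ⟧ (plug c′ s) ≈ H s c′
  ⟦⟧-agrees-wellRepresented {c′} {s} c′∈C (vanishing (s-zero , μs≈0)) _ = begin
    ⟦ A ⟧ (plug c′ s)      ≈⟨ ⟦⟧-plug-scale c′ (C-contexts c′ c′∈C) (λ j → trans (μs≈0 j) (sym (zeroˡ _))) ⟩
    0# * ⟦ A ⟧ (plug c′ s) ≈⟨ zeroˡ _ ⟩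
    0#                     ≈⟨ s-zero c′ c′∈C ⟨
    H s c′                 ∎
  ⟦⟧-agrees-wellRepresented {c′} {s} c′∈C (colinear i α (_ , s≈αb) unit) b-agrees = begin
    ⟦ A ⟧ (plug c′ s)         ≈⟨ ⟦⟧-plug-scale c′ (C-contexts c′ c′∈C) (ScaledUnit⇒≈ unit (b-unit i)) ⟩
    α * ⟦ A ⟧ (plug c′ (b i)) ≈⟨ *-congˡ (b-agrees i) ⟩
    α * H (b i) c′            ≈⟨ s≈αb c′ c′∈C ⟨
    H s c′                    ∎

  ⟦⟧-agrees : ∀ c′ → Acc _<_ (size c′) → c′ ∈ C → ∀ t → t ∈ T → ⟦ A ⟧ (plug c′ t) ≈ H t c′
  ⟦⟧-agrees c′ (acc smaller) c′∈C t t∈T with C-built c′ c′∈C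
  ... | inj₁ ≡.refl = ⟦⟧-agrees-wellRepresented ◇∈C (T-wellRepresented t t∈T) ⟦b⟧≈H
  ... | inj₂ (c₁ , c₂ , c₁∈C , c₂∈Σ◇ , ≡.refl) rewrite plug-compose c₁ c₂ t =
    ⟦⟧-agrees-wellRepresented c₁∈C (ΣT-wellRepresented (plug c₂ t) (plug∈Σ c₂∈Σ◇ t∈T)) λ i →
      ⟦⟧-agrees c₁ (smaller (size<size-compose c₁ c₂ (C-contexts c₁ c₁∈C) c₂∈Σ◇)) c₁∈C (b i) (B⊆T i)

lemma5p10 : {c ℓ₁ ℓ₂ : Level} (Σ' : RankedAlphabet) (K : HeytingField c ℓ₁ ℓ₂)
    (𝒯 : Trees.Tree Σ' → HeytingField.Carrier K)
    (tbl : Learning.Table Σ' K) →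
    Learning.LearnInvariants Σ' K 𝒯 tbl →
    Learning.Closed Σ' K 𝒯 tbl →
    Learning.Consistent Σ' K 𝒯 tbl →
    (A : Learning.MTA Σ' K (Learning.Table.d tbl)) →
    Learning.IsExtracted Σ' K 𝒯 tbl A →
    ∀ t → t ∈ Learning.Table.T tbl →
    ∀ c → c ∈ Learning.Table.C tbl →
    HeytingField._≈_ K (Learning.⟦_⟧ Σ' K A (Trees.plug Σ' c t)) (Learning.H Σ' K 𝒯 tbl t c)
lemma5p10 Σ' K 𝒯 tbl inv closed consistent A extracted t t∈T c c∈C =
  ⟦⟧-agrees c (<-wellFounded (size c)) c∈C t t∈T
  where
  open Substitution Σ'
  open ExtractedAutomaton Σ' K 𝒯 tbl inv closed consistent A extracted
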